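{- For any $N\in\mathcal{B}$ the code $\mathcal{C}$ contains exactly one of $NNc(N)$ and $c(N)c(N)N$.
   Context: Let $\mathcal{B}=\{\mathtt{A},\mathtt{C},\mathtt{G},\mathtt{T}\}$ be the genetic alphabet, and let $c\colon\mathcal{B}\to\mathcal{B}$ be the complementarity map $c(\mathtt{A})=\mathtt{T}$, $c(\mathtt{T})=\mathtt{A}$, $c(\mathtt{C})=\mathtt{G}$, $c(\mathtt{G})=\mathtt{C}$. For a codon $w=N_1N_2N_3\in\mathcal{B}^3$ its reverse complement is $\overleftarrow{c}(w)=c(N_3)c(N_2)c(N_1)$, and $\alpha(N_1N_2N_3)=N_3N_1N_2$ is the cyclic shift. A set of 3-letter words is a circular code if any concatenation of its words written on a circle can be decomposed into a concatenation of its words in a unique way. Here $\mathcal{C}$ is a maximal $C^3$ circular code: a circular code with $|\mathcal{C}|=20$, $\overleftarrow{c}(\mathcal{C})=\mathcal{C}$, and $\alpha(\mathcal{C})$ (hence also $\alpha^2(\mathcal{C})$) circular. -}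

module Defs where

open import Data.Nat using (ℕ)
open import Data.List using (List; []; _∷_; _++_; map; concat; length)
open import Data.List.Membership.Propositional using (_∈_)
open import Data.List.Relation.Unary.All using (All)
open import Data.List.Relation.Unary.Unique.Propositional using (Unique)
open import Data.Product using (_×_)
open import Relation.Binary.PropositionalEquality using (_≡_; _≢_)

data Base : Set where
  A C G T : Base

c : Base → Base
c A = T
c T = A
c C = G
c G = C

data Codon : Set where
  cod : Base → Base → Base → Codon

word : Codon → List Base
word (cod n₁ n₂ n₃) = n₁ ∷ n₂ ∷ n₃ ∷ []

revComp : Codon → Codon
revComp (cod n₁ n₂ n₃) = cod (c n₃) (c n₂) (c n₁)

α : Codon → Codon
α (cod n₁ n₂ n₃) = cod n₃ n₁ n₂

record Code : Set where
  constructor mkCode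
  field
    words  : List Codon
    unique : Unique words
open Code public

_∈C_ : Codon → Code → Set
w ∈C X = w ∈ words X

∣_∣ : Code → ℕ
∣ X ∣ = length (words X)

-- image of a code under a map of codons (as a set of codons; only membership matters)
image : (Codon → Codon) → Code → List Codon
image f X = map f (words X)

cat : List Codon → List Base
cat ws = concat (map word ws)

-- Circular code (standard definition, Berstel–Perrin / Fimmel–Michel–Strüngmann):
-- X is circular iff for all n, m ≥ 1, x₁…xₙ, y₁…yₘ ∈ X, p ∈ B*, s ∈ B⁺,
--   s x₂⋯xₙ p = y₁⋯yₘ  and  x₁ = p s   imply   n = m, p = ε, xᵢ = yᵢ.
IsCircular : List Codon → Set
IsCircular X =
  (x₁ : Codon) (xs : List Codon) (y₁ : Codon) (ys : List Codon) (p s : List Base) →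
  All (_∈ X) (x₁ ∷ xs) → All (_∈ X) (y₁ ∷ ys) →
  s ≢ [] →
  word x₁ ≡ p ++ s →
  s ++ cat xs ++ p ≡ cat (y₁ ∷ ys) →
  p ≡ [] × (x₁ ∷ xs) ≡ (y₁ ∷ ys)

-- self-complementary: ←c(X) = X, i.e. w ∈ ←c(X) ⇔ w ∈ X (←c is an involution,
-- so w ∈ ←c(X) ⇔ ←c(w) ∈ X)
SelfComplementary : Code → Set
SelfComplementary X = ∀ w → (w ∈C X → revComp w ∈C X) × (revComp w ∈C X → w ∈C X)

record IsMaximalC3 (X : Code) : Set where
  field
    circular   : IsCircular (words X)
    size20     : ∣ X ∣ ≡ 20
    selfCompl  : SelfComplementary X
    α-circular : IsCircular (image α X)
    α²-circular : IsCircular (image (λ w → α (α w)) X)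

-- A circular code never contains both w and its rotation α w, since the
-- necklace α w can also be read as w; in particular it contains no periodic codon
-- NNN. Hence X, α X, α² X and the 4 periodic codons are pairwise disjoint, and as
-- 4 + 3·20 = 64 they exhaust all codons: X meets every conjugacy class. In the
-- class of N N c(N), the rotation c(N) N N has reverse complement c(N) c(N) N,
-- while N c(N) N cannot lie in X, because with its reverse complement c(N) N c(N)
-- the necklace N c(N) N c(N) N c(N) would have two readings. Both codons cannot
-- lie in X, since the reverse complement of c(N) c(N) N is α (N N c(N)).
module Submission where

open import Defs
open import Data.Empty using (⊥-elim)
open import Data.List using (List; []; _∷_; _++_; map; length; cartesianProduct; cartesianProductWith)
open import Data.List.Membership.Propositional using (_∈_; _∉_)
open import Data.List.Membership.Propositional.Properties
  using (∈-map⁻; ∈-++⁻; ∈-cartesianProduct⁺; ∈-cartesianProductWith⁺)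
open import Data.List.Properties using (length-++; length-map; length-removeAt′)
open import Data.List.Relation.Binary.Disjoint.Propositional using (Disjoint)
open import Data.List.Relation.Unary.All as All using (All; []; _∷_)
open import Data.List.Relation.Unary.All.Properties using (¬Any⇒All¬)
open import Data.List.Relation.Unary.AllPairs using ([]; _∷_)
open import Data.List.Relation.Unary.Any using (here; there; index; _─_)
open import Data.List.Relation.Unary.Unique.Propositional using (Unique)
import Data.List.Relation.Unary.Unique.Propositional.Properties as Unique
open import Data.Nat using (suc; _+_; _≤_; z≤n; s≤s)
open import Data.Nat.Properties using (<-irrefl; module ≤-Reasoning)
open import Data.Product using (_×_; _,_; proj₁; uncurry)
open import Data.Sum as Sum using (_⊎_; inj₁; inj₂)
open import Function using (_∘_)
open import Relation.Binary.Definitions using (DecidableEquality)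
open import Relation.Binary.PropositionalEquality
  using (_≡_; _≢_; refl; sym; cong; cong₂; subst; ≢-sym; module ≡-Reasoning)
open import Relation.Nullary using (¬_; yes; no; contradiction)
open import Relation.Nullary.Decidable using (from-yes; map′; _×-dec_)

module _ {a} {A : Set a} where

  ∈-─⁺ : ∀ {x y : A} {ys} (x∈ys : x ∈ ys) → y ∈ ys → y ≢ x → y ∈ (ys ─ x∈ys)
  ∈-─⁺ (here refl) (here refl) y≢x = contradiction refl y≢x
  ∈-─⁺ (here _)    (there y∈ys) _  = y∈ys
  ∈-─⁺ (there _)   (here y≡z)   _  = here y≡z
  ∈-─⁺ (there x∈ys) (there y∈ys) y≢x = there (∈-─⁺ x∈ys y∈ys y≢x)

  unique⇒length≤ : ∀ {xs ys : List A} → Unique xs → All (_∈ ys) xs → length xs ≤ length ys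
  unique⇒length≤ [] [] = z≤n
  unique⇒length≤ {x ∷ xs} {ys} (x∉xs ∷ xs-unique) (x∈ys ∷ xs⊆ys) = begin
    suc (length xs)          ≤⟨ s≤s (unique⇒length≤ xs-unique xs⊆ys─x) ⟩
    suc (length (ys ─ x∈ys)) ≡⟨ sym (length-removeAt′ ys (index x∈ys)) ⟩
    length ys                ∎
    where
    open ≤-Reasoning
    xs⊆ys─x : All (_∈ (ys ─ x∈ys)) xs
    xs⊆ys─x = All.zipWith (λ (x≢y , y∈ys) → ∈-─⁺ x∈ys y∈ys (≢-sym x≢y)) (x∉xs , xs⊆ys)

_≟ᴮ_ : DecidableEquality Base
A ≟ᴮ A = yes refl
A ≟ᴮ C = no λ ()
A ≟ᴮ G = no λ ()
A ≟ᴮ T = no λ ()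
C ≟ᴮ A = no λ ()
C ≟ᴮ C = yes refl
C ≟ᴮ G = no λ ()
C ≟ᴮ T = no λ ()
G ≟ᴮ A = no λ ()
G ≟ᴮ C = no λ ()
G ≟ᴮ G = yes refl
G ≟ᴮ T = no λ ()
T ≟ᴮ A = no λ ()
T ≟ᴮ C = no λ ()
T ≟ᴮ G = no λ ()
T ≟ᴮ T = yes refl

_≟_ : DecidableEquality Codon
cod a b d ≟ cod a′ b′ d′ =
  map′ (λ { (refl , refl , refl) → refl }) (λ { refl → refl , refl , refl })
       (a ≟ᴮ a′ ×-dec b ≟ᴮ b′ ×-dec d ≟ᴮ d′)

open import Data.List.Membership.DecPropositional _≟_ using (_∈?_)
open import Data.List.Relation.Unary.Unique.DecPropositional _≟_ using (unique?)

c-involutive : ∀ n → c (c n) ≡ n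
c-involutive A = refl
c-involutive C = refl
c-involutive G = refl
c-involutive T = refl

α³≡id : ∀ w → α (α (α w)) ≡ w
α³≡id (cod _ _ _) = refl

α-injective : ∀ {u v} → α u ≡ α v → u ≡ v
α-injective {cod _ _ _} {cod _ _ _} refl = refl

NNc-aperiodic : ∀ N → α (cod N N (c N)) ≢ cod N N (c N)
NNc-aperiodic A ()
NNc-aperiodic C ()
NNc-aperiodic G ()
NNc-aperiodic T ()

bases : List Base
bases = A ∷ C ∷ G ∷ T ∷ []

∈-bases : ∀ n → n ∈ bases
∈-bases A = here refl
∈-bases C = there (here refl)
∈-bases G = there (there (here refl))
∈-bases T = there (there (there (here refl)))

codons : List Codon
codons = cartesianProductWith (uncurry ∘ cod) bases (cartesianProduct bases bases)

∈-codons : ∀ w → w ∈ codons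
∈-codons (cod a b d) =
  ∈-cartesianProductWith⁺ (uncurry ∘ cod) (∈-bases a) (∈-cartesianProduct⁺ (∈-bases b) (∈-bases d))

unique∧length≡64⇒∈ : ∀ {ws} → Unique ws → length ws ≡ 64 → ∀ w → w ∈ ws
unique∧length≡64⇒∈ {ws} ws-unique len w with w ∈? ws
... | yes w∈ws = w∈ws
... | no w∉ws = contradiction 65≤64 (<-irrefl refl)
  where
  65≤64 : 65 ≤ 64
  65≤64 = subst (_≤ 64) (cong suc len)
    (unique⇒length≤ {ys = codons} (¬Any⇒All¬ ws w∉ws ∷ ws-unique) (All.tabulate (λ {v} _ → ∈-codons v)))

NoConjugates : List Codon → Set
NoConjugates ws = ∀ {w} → w ∈ ws → α w ∉ ws

-- The necklace α w = d a b read from its second letter is w = a b d.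
circular⇒noConjugates : ∀ {ws} → IsCircular ws → NoConjugates ws
circular⇒noConjugates circ {cod a b d} w∈ws αw∈ws
  with circ (cod d a b) [] (cod a b d) [] (d ∷ []) (a ∷ b ∷ []) (αw∈ws ∷ []) (w∈ws ∷ []) (λ ()) refl refl
... | () , _

-- The necklace (a b a)(b a b) read from its second letter is (b a b)(a b a).
circular⇒aba∈⇒bab∉ : ∀ {ws a b} → IsCircular ws → cod a b a ∈ ws → cod b a b ∉ ws
circular⇒aba∈⇒bab∉ {a = a} {b} circ aba∈ws bab∈ws
  with circ (cod a b a) (cod b a b ∷ []) (cod b a b) (cod a b a ∷ []) (a ∷ []) (b ∷ a ∷ [])
            (aba∈ws ∷ bab∈ws ∷ []) (bab∈ws ∷ aba∈ws ∷ []) (λ ()) refl refl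
... | () , _

rotations : List Codon → List Codon
rotations ws = ws ++ map (α ∘ α) ws ++ map α ws

length-rotations : ∀ ws → length (rotations ws) ≡ length ws + (length ws + length ws)
length-rotations ws = begin
  length (ws ++ map (α ∘ α) ws ++ map α ws)             ≡⟨ length-++ ws ⟩
  length ws + length (map (α ∘ α) ws ++ map α ws)       ≡⟨ cong (length ws +_) (length-++ (map (α ∘ α) ws)) ⟩
  length ws + (length (map (α ∘ α) ws) + length (map α ws))
    ≡⟨ cong₂ (λ m n → length ws + (m + n)) (length-map (α ∘ α) ws) (length-map α ws) ⟩
  length ws + (length ws + length ws)                   ∎
  where open ≡-Reasoning

∈-rotations⁻ : ∀ ws {v} → v ∈ rotations ws → v ∈ ws ⊎ α v ∈ ws ⊎ α (α v) ∈ ws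
∈-rotations⁻ ws v∈rot with ∈-++⁻ ws v∈rot
... | inj₁ v∈ws = inj₁ v∈ws
... | inj₂ v∈rest with ∈-++⁻ (map (α ∘ α) ws) v∈rest
... | inj₁ v∈α²ws with ∈-map⁻ (α ∘ α) v∈α²ws
...   | u , u∈ws , refl = inj₂ (inj₁ (subst (_∈ ws) (sym (α³≡id u)) u∈ws))
∈-rotations⁻ ws v∈rot | inj₂ _ | inj₂ v∈αws with ∈-map⁻ α v∈αws
...   | u , u∈ws , refl = inj₂ (inj₂ (subst (_∈ ws) (sym (α³≡id u)) u∈ws))

unique-rotations : ∀ {ws} → Unique ws → NoConjugates ws → Unique (rotations ws)
unique-rotations {ws} ws-unique noConj =
  Unique.++⁺ ws-unique
    (Unique.++⁺ (Unique.map⁺ (α-injective ∘ α-injective) ws-unique) (Unique.map⁺ α-injective ws-unique) α²ws#αws)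
    ws#rest
  where
  ws#rest : Disjoint ws (map (α ∘ α) ws ++ map α ws)
  ws#rest (v∈ws , v∈rest) with ∈-++⁻ (map (α ∘ α) ws) v∈rest
  ... | inj₁ v∈α²ws with ∈-map⁻ (α ∘ α) v∈α²ws
  ...   | u , u∈ws , refl = noConj v∈ws (subst (_∈ ws) (sym (α³≡id u)) u∈ws)
  ws#rest (v∈ws , v∈rest) | inj₂ v∈αws with ∈-map⁻ α v∈αws
  ...   | u , u∈ws , refl = noConj u∈ws v∈ws
  α²ws#αws : Disjoint (map (α ∘ α) ws) (map α ws)
  α²ws#αws (v∈α²ws , v∈αws) with ∈-map⁻ (α ∘ α) v∈α²ws | ∈-map⁻ α v∈αws
  ... | u , u∈ws , refl | u′ , u′∈ws , α²u≡αu′ =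
    noConj u∈ws (subst (_∈ ws) (sym (α-injective α²u≡αu′)) u′∈ws)

triple : Base → Codon
triple n = cod n n n

periodicCodons : List Codon
periodicCodons = map triple bases

periodic#rotations : ∀ {ws} → NoConjugates ws → Disjoint periodicCodons (rotations ws)
periodic#rotations {ws} noConj (p∈periodic , p∈rot) with ∈-map⁻ triple p∈periodic
... | _ , _ , refl with ∈-rotations⁻ ws p∈rot
... | inj₁ p∈ws        = noConj p∈ws p∈ws
... | inj₂ (inj₁ p∈ws) = noConj p∈ws p∈ws
... | inj₂ (inj₂ p∈ws) = noConj p∈ws p∈ws

periodic++rotations-complete : ∀ {ws} → Unique ws → NoConjugates ws → length ws ≡ 20 →
  ∀ w → w ∈ periodicCodons ++ rotations ws
periodic++rotations-complete {ws} ws-unique noConj len = unique∧length≡64⇒∈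
  (Unique.++⁺ (from-yes (unique? periodicCodons)) (unique-rotations ws-unique noConj) (periodic#rotations noConj))
  (begin
    length (periodicCodons ++ rotations ws)     ≡⟨ length-++ periodicCodons {rotations ws} ⟩
    4 + length (rotations ws)                   ≡⟨ cong (4 +_) (length-rotations ws) ⟩
    4 + (length ws + (length ws + length ws))   ≡⟨ cong (λ n → 4 + (n + (n + n))) len ⟩
    64                                          ∎)
  where open ≡-Reasoning

noConjugates⇒meetsEveryClass : ∀ {ws} → Unique ws → NoConjugates ws → length ws ≡ 20 →
  ∀ w → α w ≡ w ⊎ w ∈ ws ⊎ α w ∈ ws ⊎ α (α w) ∈ ws
noConjugates⇒meetsEveryClass {ws} ws-unique noConj len w
  with ∈-++⁻ periodicCodons (periodic++rotations-complete ws-unique noConj len w)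
... | inj₂ w∈rot = inj₂ (∈-rotations⁻ ws w∈rot)
... | inj₁ w∈periodic with ∈-map⁻ triple w∈periodic
...   | _ , _ , refl = inj₁ refl

module _ {X : Code} (circular : IsCircular (words X)) (selfCompl : SelfComplementary X) where

  revComp-∈ : ∀ {w} → w ∈C X → revComp w ∈C X
  revComp-∈ {w} = proj₁ (selfCompl w)

  NNc∈⇒ccN∉ : ∀ N → cod N N (c N) ∈C X → ¬ (cod (c N) (c N) N ∈C X)
  NNc∈⇒ccN∉ N NNc∈X ccN∈X = circular⇒noConjugates circular NNc∈X cNN∈X
    where
    cNN∈X : cod (c N) N N ∈C X
    cNN∈X = subst (_∈C X) (cong (λ m → cod (c N) m m) (c-involutive N)) (revComp-∈ ccN∈X)

  NNc∈⊎ccN∈ : ∣ X ∣ ≡ 20 → ∀ N → cod N N (c N) ∈C X ⊎ cod (c N) (c N) N ∈C X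
  NNc∈⊎ccN∈ size N
    with noConjugates⇒meetsEveryClass (unique X) (circular⇒noConjugates circular) size (cod N N (c N))
  ... | inj₁ periodic = contradiction periodic (NNc-aperiodic N)
  ... | inj₂ (inj₁ NNc∈X) = inj₁ NNc∈X
  ... | inj₂ (inj₂ (inj₁ cNN∈X)) =
    inj₂ (subst (_∈C X) (cong (cod (c N) (c N)) (c-involutive N)) (revComp-∈ cNN∈X))
  ... | inj₂ (inj₂ (inj₂ NcN∈X)) = ⊥-elim (circular⇒aba∈⇒bab∉ circular NcN∈X cNc∈X)
    where
    cNc∈X : cod (c N) N (c N) ∈C X
    cNc∈X = subst (_∈C X) (cong (λ m → cod (c N) m (c N)) (c-involutive N)) (revComp-∈ NcN∈X)

mainTheorem4 : (X : Code) → IsMaximalC3 X → (N : Base) →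
    ((cod N N (c N) ∈C X) × ¬ (cod (c N) (c N) N ∈C X))
    ⊎ (¬ (cod N N (c N) ∈C X) × (cod (c N) (c N) N ∈C X))
mainTheorem4 X M N =
  Sum.map (λ NNc∈X → NNc∈X , notBoth NNc∈X) (λ ccN∈X → (λ NNc∈X → notBoth NNc∈X ccN∈X) , ccN∈X)
          (NNc∈⊎ccN∈ {X} circular selfCompl size20 N)
  where
  open IsMaximalC3 M
  notBoth : cod N N (c N) ∈C X → ¬ (cod (c N) (c N) N ∈C X)
  notBoth = NNc∈⇒ccN∉ {X} circular selfCompl N
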